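{- Let $H$ be a locally finite graph. If $H$ contains a subgraph which is quasi-isometric (with respect to combinatorial metrics) to the infinite $\delta$-regular tree for some $\delta\geq 3$, then $H$ does not satisfy a polynomial containment property, i.e. for no $d\ge0$ does $H$ have the $O(n^d)$-containment property.
   Context: The infinite $\delta$-regular tree is the infinite tree in which every vertex has degree exactly $\delta$. The combinatorial metric on a graph is the length of a shortest path. Metric spaces $(X_1,d_1),(X_2,d_2)$ are quasi-isometric if there are a map $f\colon X_1\to X_2$ and constants $\lambda\ge1,\epsilon\ge0,c\ge0$ with $\frac1\lambda d_1(x,y)-\epsilon\le d_2(f(x),f(y))\le\lambda d_1(x,y)+\epsilon$ for all $x,y$ and every point of $X_2$ within distance $c$ of $f(X_1)$. Given a finite set $X_0$ of vertices, a sequence $\{W_k\}_{k\geq1}$ of vertex sets is an $\{f_n\}$-containment strategy for $X_0$ if: (1) $|W_n|\le f_n$ for all $n\ge1$; (2) $X_n\cap W_{n+1}=\emptyset$ for all $n\ge0$, where for $n>0$, $X_n$ is the set of vertices connected to a vertex of $X_{n-1}$ by a path of length at most $1$ containing no vertex of $W_1\cup\cdots\cup W_n$; (3) there is $N>0$ with $X_n=X_N$ for all $n\ge N$. A graph has the $\{f_n\}$-containment property if every finite vertex set admits such a strategy, and the $O(n^d)$-containment property if it has the $\{f_n\}$-containment property for some non-negative integer sequence with $f_n=O(n^d)$. -}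

module Defs where

open import Level using (0ℓ)
open import Data.Nat using (ℕ; zero; suc; _+_; _*_; _^_; _≤_; _<_)
open import Data.Nat.Properties using (1+n≢n)
open import Data.Fin using (Fin)
open import Data.List using (List; []; _∷_; length)
open import Data.List.Membership.Propositional using (_∈_)
open import Data.Product using (Σ; Σ-syntax; ∃; ∃-syntax; _×_; _,_; proj₁)
open import Data.Sum using (_⊎_; inj₁; inj₂)
open import Data.Unit using (⊤)
open import Data.Empty using (⊥)
open import Relation.Nullary using (¬_)
open import Relation.Binary.PropositionalEquality using (_≡_; refl; sym; cong)

record Graph : Set₁ where
  field
    V     : Set
    E     : V → V → Set
    E-sym : ∀ {u v} → E u v → E v u
    E-irr : ∀ {v} → ¬ E v v

open Graph public

LocallyFinite : Graph → Set
LocallyFinite G = (v : V G) → Σ[ ns ∈ List (V G) ] (∀ u → E G v u → u ∈ ns)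

-- Walk G k u v : there is a walk from u to v of length at most k,
-- i.e. the combinatorial distance satisfies d(u,v) ≤ k
-- (d(u,v) = ∞ when no walk exists at all).
data Walk (G : Graph) : ℕ → V G → V G → Set where
  here : ∀ {k v} → Walk G k v v
  step : ∀ {k u w v} → E G u w → Walk G k w v → Walk G (suc k) u v

record Subgraph (G : Graph) : Set₁ where
  field
    P     : V G → Set
    F     : V G → V G → Set
    F⊆E   : ∀ {u v} → F u v → E G u v
    F-src : ∀ {u v} → F u v → P u
    F-tgt : ∀ {u v} → F u v → P v
    F-sym : ∀ {u v} → F u v → F v u

asGraph : {G : Graph} → Subgraph G → Graph
asGraph {G} S = record
  { V     = Σ (V G) P
  ; E     = λ x y → F (proj₁ x) (proj₁ y)
  ; E-sym = F-sym
  ; E-irr = λ e → E-irr G (F⊆E e)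
  }
  where open Subgraph S

-- Quasi-isometry w.r.t. combinatorial metrics d₁ (of G₁), d₂ (of G₂):
-- f : V₁ → V₂, λ ≥ 1, ε, c with
--   d₂(f x, f y) ≤ λ d₁(x,y) + ε,
--   d₁(x,y)/λ - ε ≤ d₂(f x, f y)   (equivalently d₁ ≤ λ d₂ + λ ε),
--   every vertex of G₂ within distance c of f(V₁).
-- Constants are taken in ℕ (WLOG, since distances are integers: real
-- constants can be rounded up).

QuasiIsometric : Graph → Graph → Set
QuasiIsometric G₁ G₂ =
  Σ[ f ∈ (V G₁ → V G₂) ] Σ[ lam ∈ ℕ ] Σ[ ε ∈ ℕ ] Σ[ c ∈ ℕ ]
    (1 ≤ lam)
  × (∀ x y k → Walk G₁ k x y → Walk G₂ (lam * k + ε) (f x) (f y))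
  × (∀ x y k → Walk G₂ k (f x) (f y) → Walk G₁ (lam * k + lam * ε) x y)
  × (∀ y → Σ[ x ∈ V G₁ ] Walk G₂ c (f x) y)

-- The infinite δ-regular tree, modelled as the Cayley graph of the free
-- product of δ copies of ℤ/2: vertices are reduced words over Fin δ
-- (no two consecutive letters equal), w ~ a ∷ w.

Reduced : {δ : ℕ} → List (Fin δ) → Set
Reduced []           = ⊤
Reduced (a ∷ [])     = ⊤
Reduced (a ∷ b ∷ w)  = ¬ (a ≡ b) × Reduced (b ∷ w)

private
  len-irr : ∀ {A : Set} {w : List A} {a : A} → ¬ (w ≡ a ∷ w)
  len-irr {w = w} eq = 1+n≢n (sym (cong length eq))

RegularTree : ℕ → Graph
RegularTree δ = record
  { V     = Σ (List (Fin δ)) Reduced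
  ; E     = λ x y → (Σ[ a ∈ Fin δ ] proj₁ y ≡ a ∷ proj₁ x)
                  ⊎ (Σ[ a ∈ Fin δ ] proj₁ x ≡ a ∷ proj₁ y)
  ; E-sym = λ { (inj₁ p) → inj₂ p ; (inj₂ p) → inj₁ p }
  ; E-irr = λ { (inj₁ (a , eq)) → len-irr eq ; (inj₂ (a , eq)) → len-irr eq }
  }

-- Containment strategies.  Sequences are indexed by ℕ; W 0 and f 0 are
-- unused (the paper's sequences start at index 1).  Finite vertex sets
-- are given as lists.

module _ (G : Graph) where

  InWs : (ℕ → List (V G)) → ℕ → V G → Set
  InWs W n v = Σ[ k ∈ ℕ ] (1 ≤ k) × (k ≤ n) × (v ∈ W k)

  Xs : List (V G) → (ℕ → List (V G)) → ℕ → V G → Set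
  Xs X₀ W zero    v = v ∈ X₀
  Xs X₀ W (suc n) v =
    Σ[ u ∈ V G ] Xs X₀ W n u × (u ≡ v ⊎ E G u v)
                × ¬ InWs W (suc n) u × ¬ InWs W (suc n) v

  ContainmentStrategy : (ℕ → ℕ) → List (V G) → (ℕ → List (V G)) → Set
  ContainmentStrategy f X₀ W =
      (∀ n → 1 ≤ n → length (W n) ≤ f n)
    × (∀ n v → Xs X₀ W n v → ¬ (v ∈ W (suc n)))
    × (Σ[ N ∈ ℕ ] (0 < N) × (∀ n → N ≤ n → ∀ v →
          (Xs X₀ W n v → Xs X₀ W N v) × (Xs X₀ W N v → Xs X₀ W n v)))

  ContainmentProperty : (ℕ → ℕ) → Set
  ContainmentProperty f =
    (X₀ : List (V G)) → Σ[ W ∈ (ℕ → List (V G)) ] ContainmentStrategy f X₀ W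

  BigO-pow : (ℕ → ℕ) → ℕ → Set
  BigO-pow f d = Σ[ C ∈ ℕ ] Σ[ n₀ ∈ ℕ ] (∀ n → n₀ ≤ n → f n ≤ C * n ^ d)

  PolyContainment : ℕ → Set
  PolyContainment d = Σ[ f ∈ (ℕ → ℕ) ] BigO-pow f d × ContainmentProperty f

-- Start a fire in H on the s-images of the tree vertices at depth r, where s is a coarse
-- inverse of the quasi-isometry. Along every ray of grandchildren the fire advances one
-- level per K time steps, unless a defender placed in time lies within a fixed radius R of the
-- ray. The fire is eventually confined to a finite ball, so each of the ≥ (δ-1)^(r+2M) leaves at
-- depth r + 2M is charged either to a vertex of that ball or to a defender near one of its
-- ancestors. Defenders placed by time K (j+1) number at most P 2^j (the polynomial bound), and
-- each is charged by at most Vol (δ-1)^(2(M-j)) leaves through ancestors at depth r + 2j; the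
-- resulting geometric series is smaller than the number of leaves once r and M are large.
-- The argument is classical, which is harmless since its conclusion is ⊥.

module Submission where

open import Defs
open import Data.Bool using (if_then_else_)
open import Data.Empty using (⊥; ⊥-elim)
open import Data.Fin using (Fin; zero; suc)
import Data.Fin.Properties as Fin
open import Data.List using (List; []; _∷_; length; _++_; map; concatMap; upTo; allFin; drop; _∷ʳ_)
open import Data.List.Properties using (length-++; length-map; length-tabulate; length-upTo; map-tabulate; map-upTo; upTo-∷ʳ; ++-assoc)
import Data.List.Properties as List
open import Data.List.Membership.Propositional using (_∈_; find; lose)
open import Data.List.Membership.Propositional.Properties
  using (∈-concatMap⁻; ∈-concatMap⁺; ∈-map⁺; ∈-allFin; ∈-++⁺ˡ; ∈-++⁺ʳ; ∈-upTo⁻; ∈-upTo⁺)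
open import Data.List.Relation.Unary.Any using (here; there)
open import Data.Nat
open import Data.Nat.DivMod using (_/_; _%_; m≡m%n+[m/n]*n; m%n<n; m/n*n≤m)
open import Data.Nat.Properties
open import Data.Nat.Tactic.RingSolver using (solve-∀)
open import Data.Product using (Σ; Σ-syntax; _×_; _,_; proj₁; proj₂)
open import Data.Sum using (_⊎_; inj₁; inj₂)
open import Data.Unit using (tt)
open import Effect.Monad using (RawMonad)
open import Function using (_∘_; id)
open import Level using (0ℓ)
open import Relation.Binary.PropositionalEquality
open import Relation.Nullary using (¬_; Dec; yes; no; does; ¬¬-excluded-middle)
open import Relation.Nullary.Decidable using (decidable-stable)
open import Relation.Nullary.Negation using (¬¬-Monad)

open RawMonad (¬¬-Monad {a = 0ℓ}) using (pure; _>>=_)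

private
  variable
    A B : Set

∑ : {A : Set} → List A → (A → ℕ) → ℕ
∑ []       g = 0
∑ (x ∷ xs) g = g x + ∑ xs g

syntax ∑ xs (λ x → e) = ∑[ x ∈ xs ] e

∑-mono : (xs : List A) {g h : A → ℕ} → (∀ x → x ∈ xs → g x ≤ h x) → ∑ xs g ≤ ∑ xs h
∑-mono []       le = z≤n
∑-mono (x ∷ xs) le = +-mono-≤ (le x (here refl)) (∑-mono xs (λ y y∈ → le y (there y∈)))

∑-cong : (xs : List A) {g h : A → ℕ} → (∀ x → x ∈ xs → g x ≡ h x) → ∑ xs g ≡ ∑ xs h
∑-cong []       eq = refl
∑-cong (x ∷ xs) eq = cong₂ _+_ (eq x (here refl)) (∑-cong xs (λ y y∈ → eq y (there y∈)))

∑-const : (xs : List A) (k : ℕ) → ∑[ _ ∈ xs ] k ≡ length xs * k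
∑-const []       k = refl
∑-const (x ∷ xs) k = cong (k +_) (∑-const xs k)

∑-≤-const : (xs : List A) {g : A → ℕ} {k : ℕ} → (∀ x → x ∈ xs → g x ≤ k) → ∑ xs g ≤ length xs * k
∑-≤-const xs {k = k} le = ≤-trans (∑-mono xs le) (≤-reflexive (∑-const xs k))

length≤∑ : (xs : List A) {g : A → ℕ} → (∀ x → x ∈ xs → 1 ≤ g x) → length xs ≤ ∑ xs g
length≤∑ xs le = ≤-trans (≤-reflexive (trans (sym (*-identityʳ _)) (sym (∑-const xs 1)))) (∑-mono xs le)

∑-distrib-+ : (xs : List A) (g h : A → ℕ) → ∑[ x ∈ xs ] (g x + h x) ≡ ∑ xs g + ∑ xs h
∑-distrib-+ []       g h = refl
∑-distrib-+ (x ∷ xs) g h = begin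
  g x + h x + ∑[ y ∈ xs ] (g y + h y)  ≡⟨ cong (g x + h x +_) (∑-distrib-+ xs g h) ⟩
  g x + h x + (∑ xs g + ∑ xs h)        ≡⟨ interchange (g x) (h x) (∑ xs g) (∑ xs h) ⟩
  g x + ∑ xs g + (h x + ∑ xs h)        ∎
  where
  open ≡-Reasoning
  interchange : ∀ a b c d → a + b + (c + d) ≡ a + c + (b + d)
  interchange = solve-∀

∑-distribˡ-* : (xs : List A) (k : ℕ) (g : A → ℕ) → ∑[ x ∈ xs ] (k * g x) ≡ k * ∑ xs g
∑-distribˡ-* []       k g = sym (*-zeroʳ k)
∑-distribˡ-* (x ∷ xs) k g = trans (cong (k * g x +_) (∑-distribˡ-* xs k g)) (sym (*-distribˡ-+ k (g x) (∑ xs g)))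

∑-∈ : {xs : List A} (g : A → ℕ) {x : A} → x ∈ xs → g x ≤ ∑ xs g
∑-∈ {xs = y ∷ xs} g (here refl) = m≤m+n (g y) (∑ xs g)
∑-∈ {xs = y ∷ xs} g (there x∈)  = ≤-trans (∑-∈ g x∈) (m≤n+m (∑ xs g) (g y))

∑-++ : (xs ys : List A) (g : A → ℕ) → ∑ (xs ++ ys) g ≡ ∑ xs g + ∑ ys g
∑-++ []       ys g = refl
∑-++ (x ∷ xs) ys g = trans (cong (g x +_) (∑-++ xs ys g)) (sym (+-assoc (g x) (∑ xs g) (∑ ys g)))

∑-map : (xs : List B) (f : B → A) (g : A → ℕ) → ∑ (map f xs) g ≡ ∑[ x ∈ xs ] g (f x)
∑-map []       f g = refl
∑-map (x ∷ xs) f g = cong (g (f x) +_) (∑-map xs f g)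

∑-concatMap : (xs : List B) (h : B → List A) (g : A → ℕ) →
              ∑ (concatMap h xs) g ≡ ∑[ x ∈ xs ] ∑ (h x) g
∑-concatMap []       h g = refl
∑-concatMap (x ∷ xs) h g = trans (∑-++ (h x) (concatMap h xs) g) (cong (∑ (h x) g +_) (∑-concatMap xs h g))

∑-comm : (xs : List A) (ys : List B) (g : A → B → ℕ) →
         ∑[ x ∈ xs ] ∑[ y ∈ ys ] g x y ≡ ∑[ y ∈ ys ] ∑[ x ∈ xs ] g x y
∑-comm []       ys g = sym (trans (∑-const ys 0) (*-zeroʳ (length ys)))
∑-comm (x ∷ xs) ys g = trans (cong (∑ ys (g x) +_) (∑-comm xs ys g))
                             (sym (∑-distrib-+ ys (g x) (λ y → ∑[ x' ∈ xs ] g x' y)))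

length-concatMap : (xs : List A) (h : A → List B) → length (concatMap h xs) ≡ ∑[ x ∈ xs ] length (h x)
length-concatMap []       h = refl
length-concatMap (x ∷ xs) h = trans (length-++ (h x)) (cong (length (h x) +_) (length-concatMap xs h))

∑-upTo-suc : (n : ℕ) (g : ℕ → ℕ) → ∑ (upTo (suc n)) g ≡ g 0 + ∑[ i ∈ upTo n ] g (suc i)
∑-upTo-suc n g = cong (g 0 +_) (trans (cong (λ xs → ∑ xs g) (sym (map-upTo suc n))) (∑-map (upTo n) suc g))

∑-upTo-∷ʳ : (n : ℕ) (g : ℕ → ℕ) → ∑ (upTo (suc n)) g ≡ ∑ (upTo n) g + g n
∑-upTo-∷ʳ n g = begin
  ∑ (upTo (suc n)) g     ≡⟨ cong (λ xs → ∑ xs g) (sym (upTo-∷ʳ n)) ⟩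
  ∑ (upTo n ∷ʳ n) g      ≡⟨ ∑-++ (upTo n) (n ∷ []) g ⟩
  ∑ (upTo n) g + (g n + 0) ≡⟨ cong (∑ (upTo n) g +_) (+-identityʳ (g n)) ⟩
  ∑ (upTo n) g + g n     ∎
  where open ≡-Reasoning

drop-length-++ : (p w : List A) → drop (length p) (p ++ w) ≡ w
drop-length-++ []      w = refl
drop-length-++ (a ∷ p) w = drop-length-++ p w

𝟙 : {P : Set} → Dec P → ℕ
𝟙 d = if does d then 1 else 0

𝟙≤1 : {P : Set} (p? : Dec P) → 𝟙 p? ≤ 1
𝟙≤1 (yes _) = s≤s z≤n
𝟙≤1 (no _)  = z≤n

𝟙-yes : {P : Set} (p? : Dec P) → P → 𝟙 p? ≡ 1
𝟙-yes (yes _) _ = refl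
𝟙-yes (no ¬p) p = ⊥-elim (¬p p)

𝟙-no : {P : Set} (p? : Dec P) → ¬ P → 𝟙 p? ≡ 0
𝟙-no (yes p) ¬p = ⊥-elim (¬p p)
𝟙-no (no _)  _  = refl

𝟙-mono : {P Q : Set} → (P → Q) → (p? : Dec P) (q? : Dec Q) → 𝟙 p? ≤ 𝟙 q?
𝟙-mono P⇒Q (yes p) q? = ≤-reflexive (sym (𝟙-yes q? (P⇒Q p)))
𝟙-mono P⇒Q (no _)  q? = z≤n

∑-allFin-suc : ∀ n (g : Fin (suc n) → ℕ) → ∑ (allFin (suc n)) g ≡ g zero + ∑[ a ∈ allFin n ] g (suc a)
∑-allFin-suc n g = cong (g zero +_) (trans (cong (λ as → ∑ as g) (sym (map-tabulate id suc))) (∑-map (allFin n) suc g))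

∑-𝟙-allFin : ∀ {n} (b : Fin n) → ∑[ a ∈ allFin n ] 𝟙 (a Fin.≟ b) ≡ 1
∑-𝟙-allFin {suc n} zero    = trans (∑-allFin-suc n (λ a → 𝟙 (a Fin.≟ zero)))
                               (cong suc (trans (∑-const (allFin n) 0) (*-zeroʳ (length (allFin n)))))
∑-𝟙-allFin {suc n} (suc b) = trans (∑-allFin-suc n (λ a → 𝟙 (a Fin.≟ suc b))) (∑-𝟙-allFin b)

length-allFin : ∀ n → length (allFin n) ≡ n
length-allFin n = length-tabulate id

double : ℕ → ℕ
double zero    = zero
double (suc n) = suc (suc (double n))

^-double : (b n : ℕ) → b ^ double n ≡ (b * b) ^ n
^-double b zero    = refl
^-double b (suc n) = trans (cong (λ m → b * (b * m)) (^-double b n)) (sym (*-assoc b b _))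

double-mono : ∀ {m n} → m ≤ n → double m ≤ double n
double-mono z≤n       = z≤n
double-mono (s≤s m≤n) = s≤s (s≤s (double-mono m≤n))

double-+-∸ : ∀ {m n} → m ≤ n → double m + double (n ∸ m) ≡ double n
double-+-∸ z≤n       = refl
double-+-∸ (s≤s m≤n) = cong (2 +_) (double-+-∸ m≤n)

n<b^n : (b : ℕ) → 2 ≤ b → (n : ℕ) → n < b ^ n
n<b^n b 2≤b zero    = s≤s z≤n
n<b^n b 2≤b (suc n) = begin
  1 + suc n       ≤⟨ +-mono-≤ (≤-trans (s≤s z≤n) IH) IH ⟩
  b ^ n + b ^ n   ≡⟨ cong (b ^ n +_) (sym (+-identityʳ (b ^ n))) ⟩
  2 * b ^ n       ≤⟨ *-monoˡ-≤ (b ^ n) 2≤b ⟩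
  b * b ^ n       ∎
  where
  open ≤-Reasoning
  IH = n<b^n b 2≤b n

n≤n^suc : (n d : ℕ) → n ≤ n ^ suc d
n≤n^suc zero    d = z≤n
n≤n^suc (suc n) d = m≤m*n (suc n) (suc n ^ d) {{m^n≢0 (suc n) d}}

^-distribʳ-* : (m n e : ℕ) → (m * n) ^ e ≡ m ^ e * n ^ e
^-distribʳ-* m n zero    = refl
^-distribʳ-* m n (suc e) = trans (cong (m * n *_) (^-distribʳ-* m n e)) (interchange m n (m ^ e) (n ^ e))
  where
  interchange : ∀ a b c d → a * b * (c * d) ≡ a * c * (b * d)
  interchange = solve-∀

-- Write i = (i / e) * e + i % e; then suc i ≤ e * suc (i / e) ≤ e * 2 ^ (i / e).
suc^≤exp : (e : ℕ) .{{_ : NonZero e}} (i : ℕ) → suc i ^ e ≤ e ^ e * 2 ^ i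
suc^≤exp e i = begin
  suc i ^ e                ≤⟨ ^-monoˡ-≤ e suc-i≤ ⟩
  (e * 2 ^ (i / e)) ^ e    ≡⟨ ^-distribʳ-* e (2 ^ (i / e)) e ⟩
  e ^ e * (2 ^ (i / e)) ^ e ≡⟨ cong (e ^ e *_) (^-*-assoc 2 (i / e) e) ⟩
  e ^ e * 2 ^ (i / e * e)  ≤⟨ *-monoʳ-≤ (e ^ e) (^-monoʳ-≤ 2 (m/n*n≤m i e)) ⟩
  e ^ e * 2 ^ i            ∎
  where
  open ≤-Reasoning
  suc-i≤ : suc i ≤ e * 2 ^ (i / e)
  suc-i≤ = begin
    suc i                        ≡⟨ cong suc (m≡m%n+[m/n]*n i e) ⟩
    suc (i % e + i / e * e)      ≤⟨ +-monoˡ-≤ (i / e * e) (m%n<n i e) ⟩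
    e + i / e * e                ≡⟨ cong (e +_) (*-comm (i / e) e) ⟩
    e + e * (i / e)              ≡⟨ sym (*-suc e (i / e)) ⟩
    e * suc (i / e)              ≤⟨ *-monoʳ-≤ e (n<b^n 2 ≤-refl (i / e)) ⟩
    e * 2 ^ (i / e)              ∎

geometric-bound : (β : ℕ) → 4 ≤ β → (M : ℕ) → ∑[ j ∈ upTo M ] (2 ^ j * β ^ (M ∸ j)) ≤ 2 * β ^ M
geometric-bound β 4≤β zero    = z≤n
geometric-bound β 4≤β (suc M) = begin
  ∑[ j ∈ upTo (suc M) ] (2 ^ j * β ^ (suc M ∸ j))
    ≡⟨ ∑-upTo-suc M (λ j → 2 ^ j * β ^ (suc M ∸ j)) ⟩
  1 * β ^ suc M + ∑[ j ∈ upTo M ] (2 * 2 ^ j * β ^ (M ∸ j))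
    ≡⟨ cong₂ _+_ (*-identityˡ (β ^ suc M)) (∑-cong (upTo M) (λ j _ → *-assoc 2 (2 ^ j) (β ^ (M ∸ j)))) ⟩
  β ^ suc M + ∑[ j ∈ upTo M ] (2 * (2 ^ j * β ^ (M ∸ j)))
    ≡⟨ cong (β ^ suc M +_) (∑-distribˡ-* (upTo M) 2 (λ j → 2 ^ j * β ^ (M ∸ j))) ⟩
  β ^ suc M + 2 * ∑[ j ∈ upTo M ] (2 ^ j * β ^ (M ∸ j))
    ≤⟨ +-monoʳ-≤ (β ^ suc M) (*-monoʳ-≤ 2 (geometric-bound β 4≤β M)) ⟩
  β ^ suc M + 2 * (2 * β ^ M)
    ≡⟨ cong (β ^ suc M +_) (sym (*-assoc 2 2 (β ^ M))) ⟩
  β ^ suc M + 4 * β ^ M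
    ≤⟨ +-monoʳ-≤ (β ^ suc M) (*-monoˡ-≤ (β ^ M) 4≤β) ⟩
  β ^ suc M + β ^ suc M
    ≡⟨ cong (β ^ suc M +_) (sym (+-identityʳ (β ^ suc M))) ⟩
  2 * β ^ suc M ∎
  where open ≤-Reasoning

module _ (f : ℕ → ℕ) (d C n₀ : ℕ) (f≤Cn^d : ∀ n → n₀ ≤ n → f n ≤ C * n ^ d) where

  private
    -- bounds the finitely many values of f below n₀
    F₀ : ℕ
    F₀ = ∑[ i ∈ upTo n₀ ] f i

  ≤-polynomial : ∀ n → f n ≤ F₀ + C * n ^ d
  ≤-polynomial n with n <? n₀
  ... | yes n<n₀ = ≤-trans (∑-∈ f (∈-upTo⁺ n<n₀)) (m≤m+n F₀ (C * n ^ d))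
  ... | no n≮n₀  = ≤-trans (f≤Cn^d n (≮⇒≥ n≮n₀)) (m≤n+m (C * n ^ d) F₀)

  ∑-≤-polynomial : ∀ n → ∑[ i ∈ upTo n ] f (suc i) ≤ (F₀ + C) * n ^ suc d
  ∑-≤-polynomial n = begin
    ∑[ i ∈ upTo n ] f (suc i)     ≤⟨ ∑-≤-const (upTo n) termwise ⟩
    length (upTo n) * (F₀ + C * n ^ d) ≡⟨ cong (_* (F₀ + C * n ^ d)) (length-upTo n) ⟩
    n * (F₀ + C * n ^ d)          ≡⟨ rearrange n F₀ C (n ^ d) ⟩
    n * F₀ + C * n ^ suc d        ≤⟨ +-monoˡ-≤ (C * n ^ suc d) nF₀≤ ⟩
    F₀ * n ^ suc d + C * n ^ suc d ≡⟨ sym (*-distribʳ-+ (n ^ suc d) F₀ C) ⟩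
    (F₀ + C) * n ^ suc d          ∎
    where
    open ≤-Reasoning
    nF₀≤ : n * F₀ ≤ F₀ * n ^ suc d
    nF₀≤ = ≤-trans (*-monoˡ-≤ F₀ (n≤n^suc n d)) (≤-reflexive (*-comm (n ^ suc d) F₀))
    termwise : ∀ i → i ∈ upTo n → f (suc i) ≤ F₀ + C * n ^ d
    termwise i i∈ = ≤-trans (≤-polynomial (suc i)) (+-monoʳ-≤ F₀ (*-monoʳ-≤ C (^-monoˡ-≤ d (∈-upTo⁻ i∈))))
    rearrange : ∀ n a c m → n * (a + c * m) ≡ n * a + c * (n * m)
    rearrange = solve-∀

  polynomial-budget : (K : ℕ) → Σ[ P ∈ ℕ ] (∀ j → ∑[ i ∈ upTo (K * suc j) ] f (suc i) ≤ P * 2 ^ j)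
  polynomial-budget K = (F₀ + C) * (K ^ e * e ^ e) , bound
    where
    e = suc d
    bound : ∀ j → ∑[ i ∈ upTo (K * suc j) ] f (suc i) ≤ (F₀ + C) * (K ^ e * e ^ e) * 2 ^ j
    bound j = begin
      ∑[ i ∈ upTo (K * suc j) ] f (suc i) ≤⟨ ∑-≤-polynomial (K * suc j) ⟩
      (F₀ + C) * (K * suc j) ^ e          ≡⟨ cong ((F₀ + C) *_) (^-distribʳ-* K (suc j) e) ⟩
      (F₀ + C) * (K ^ e * suc j ^ e)      ≤⟨ *-monoʳ-≤ (F₀ + C) (*-monoʳ-≤ (K ^ e) (suc^≤exp e j)) ⟩
      (F₀ + C) * (K ^ e * (e ^ e * 2 ^ j)) ≡⟨ reassoc (F₀ + C) (K ^ e) (e ^ e) (2 ^ j) ⟩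
      (F₀ + C) * (K ^ e * e ^ e) * 2 ^ j  ∎
      where
      open ≤-Reasoning
      reassoc : ∀ a k x y → a * (k * (x * y)) ≡ a * (k * x) * y
      reassoc = solve-∀

module _ (G : Graph) where

  walk-mono : ∀ {k k′ x y} → k ≤ k′ → Walk G k x y → Walk G k′ x y
  walk-mono _         here       = here
  walk-mono (s≤s k≤k′) (step e w) = step e (walk-mono k≤k′ w)

  walk-++ : ∀ {k l x y z} → Walk G k x y → Walk G l y z → Walk G (k + l) x z
  walk-++ {k} {l} here w′ = walk-mono (m≤n+m l k) w′
  walk-++ (step e w) w′ = step e (walk-++ w w′)

  walk-∷ʳ : ∀ {k x y z} → Walk G k x y → E G y z → Walk G (suc k) x z
  walk-∷ʳ here       e = step e here
  walk-∷ʳ (step e′ w) e = step e′ (walk-∷ʳ w e)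

  walk-reverse : ∀ {k x y} → Walk G k x y → Walk G k y x
  walk-reverse here       = here
  walk-reverse (step e w) = walk-∷ʳ (walk-reverse w) (E-sym G e)

  walk-trivial-or-neighbour : ∀ {k x y} → Walk G k x y → x ≡ y ⊎ Σ[ u ∈ V G ] E G x u
  walk-trivial-or-neighbour here                = inj₁ refl
  walk-trivial-or-neighbour (step {w = u} e _) = inj₂ (u , e)

module RegularTreeCounting (δ : ℕ) where

  T : Graph
  T = RegularTree δ

  Word : Set
  Word = List (Fin δ)

  Vertex : Set
  Vertex = V T

  root : Vertex
  root = [] , tt

  _≟ᵂ_ : (u v : Word) → Dec (u ≡ v)
  _≟ᵂ_ = List.≡-dec Fin._≟_

  multiplicity : List Word → Word → ℕ
  multiplicity ws u = ∑[ w ∈ ws ] 𝟙 (u ≟ᵂ w)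

  ∈⇒multiplicity : {ws : List Word} {u : Word} → u ∈ ws → 1 ≤ multiplicity ws u
  ∈⇒multiplicity {ws} {u} u∈ = ≤-trans (≤-reflexive (sym (𝟙-yes (u ≟ᵂ u) refl))) (∑-∈ (λ w → 𝟙 (u ≟ᵂ w)) u∈)

  child : Fin δ → Vertex → List Vertex
  child a ([] , _) = (a ∷ [] , tt) ∷ []
  child a (b ∷ w , r) with a Fin.≟ b
  ... | yes _   = []
  ... | no a≢b = (a ∷ b ∷ w , a≢b , r) ∷ []

  children : Vertex → List Vertex
  children x = concatMap (λ a → child a x) (allFin δ)

  descendants : ℕ → Vertex → List Vertex
  descendants zero    x = x ∷ []
  descendants (suc m) x = concatMap (descendants m) (children x)

  ∈-child⇒≡ : ∀ a x {c} → c ∈ child a x → proj₁ c ≡ a ∷ proj₁ x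
  ∈-child⇒≡ a ([] , _)    (here refl) = refl
  ∈-child⇒≡ a (b ∷ w , r) c∈ with a Fin.≟ b
  ∈-child⇒≡ a (b ∷ w , r) ()          | yes _
  ∈-child⇒≡ a (b ∷ w , r) (here refl) | no _ = refl

  ∈-children⇒≡ : ∀ x {c} → c ∈ children x → Σ[ a ∈ Fin δ ] proj₁ c ≡ a ∷ proj₁ x
  ∈-children⇒≡ x c∈ with find (∈-concatMap⁻ (λ a → child a x) {xs = allFin δ} c∈)
  ... | a , _ , c∈child = a , ∈-child⇒≡ a x c∈child

  children-adjacent : ∀ x {c} → c ∈ children x → E T x c
  children-adjacent x c∈ = inj₁ (∈-children⇒≡ x c∈)

  ∈-descendants⇒≡ : ∀ m x {t} → t ∈ descendants m x →
                    Σ[ p ∈ Word ] (proj₁ t ≡ p ++ proj₁ x) × (length p ≡ m)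
  ∈-descendants⇒≡ zero    x (here refl) = [] , refl , refl
  ∈-descendants⇒≡ (suc m) x t∈
    with find (∈-concatMap⁻ (descendants m) {xs = children x} t∈)
  ... | c , c∈ , t∈′ with ∈-descendants⇒≡ m c t∈′ | ∈-children⇒≡ x c∈
  ... | p , t≡ , ∣p∣≡m | a , c≡ =
    p ++ a ∷ [] ,
    trans t≡ (trans (cong (p ++_) c≡) (sym (++-assoc p (a ∷ []) (proj₁ x)))) ,
    trans (length-++ p) (trans (cong (_+ 1) ∣p∣≡m) (+-comm m 1))

  ∈-descendants-+⁻ : ∀ m n x {t} → t ∈ descendants (m + n) x →
                     Σ[ y ∈ Vertex ] y ∈ descendants m x × t ∈ descendants n y
  ∈-descendants-+⁻ zero    n x t∈ = x , here refl , t∈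
  ∈-descendants-+⁻ (suc m) n x t∈
    with find (∈-concatMap⁻ (descendants (m + n)) {xs = children x} t∈)
  ... | c , c∈ , t∈′ with ∈-descendants-+⁻ m n c t∈′
  ... | y , y∈ , t∈″ = y , ∈-concatMap⁺ (descendants m) {xs = children x} (lose {P = λ c → y ∈ descendants m c} c∈ y∈) , t∈″

  descendant-walk : ∀ m x {t} → t ∈ descendants m x → Walk T m x t
  descendant-walk zero    x (here refl) = here
  descendant-walk (suc m) x t∈
    with find (∈-concatMap⁻ (descendants m) {xs = children x} t∈)
  ... | c , c∈ , t∈′ = step (children-adjacent x c∈) (descendant-walk m c t∈′)

  depth-descendants : ∀ m x {t} → t ∈ descendants m x → length (proj₁ t) ≡ m + length (proj₁ x)
  depth-descendants m x t∈ with ∈-descendants⇒≡ m x t∈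
  ... | p , t≡ , ∣p∣≡m = trans (cong length t≡) (trans (length-++ p) (cong (_+ length (proj₁ x)) ∣p∣≡m))

  ∑-descendants-+ : ∀ m n x (g : Vertex → ℕ) →
                    ∑ (descendants (m + n) x) g ≡ ∑[ y ∈ descendants m x ] ∑ (descendants n y) g
  ∑-descendants-+ zero    n x g = sym (+-identityʳ _)
  ∑-descendants-+ (suc m) n x g = begin
    ∑ (concatMap (descendants (m + n)) (children x)) g
      ≡⟨ ∑-concatMap (children x) (descendants (m + n)) g ⟩
    ∑[ c ∈ children x ] ∑ (descendants (m + n) c) g
      ≡⟨ ∑-cong (children x) (λ c _ → ∑-descendants-+ m n c g) ⟩
    ∑[ c ∈ children x ] ∑[ y ∈ descendants m c ] ∑ (descendants n y) g
      ≡⟨ sym (∑-concatMap (children x) (descendants m) (λ y → ∑ (descendants n y) g)) ⟩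
    ∑[ y ∈ concatMap (descendants m) (children x) ] ∑ (descendants n y) g ∎
    where open ≡-Reasoning

  length-children-root : length (children root) ≡ δ
  length-children-root = begin
    length (children root)           ≡⟨ length-concatMap (allFin δ) (λ a → child a root) ⟩
    ∑[ _ ∈ allFin δ ] 1              ≡⟨ ∑-const (allFin δ) 1 ⟩
    length (allFin δ) * 1            ≡⟨ *-identityʳ _ ⟩
    length (allFin δ)                ≡⟨ length-allFin δ ⟩
    δ                                ∎
    where open ≡-Reasoning

  -- Every letter except the first letter b of the word gives a child.
  length-children-∷ : ∀ b w (r : Reduced (b ∷ w)) → length (children (b ∷ w , r)) + 1 ≡ δ
  length-children-∷ b w r = begin
    length (children x) + 1
      ≡⟨ cong₂ _+_ (length-concatMap (allFin δ) (λ a → child a x)) (sym (∑-𝟙-allFin b)) ⟩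
    ∑[ a ∈ allFin δ ] length (child a x) + ∑[ a ∈ allFin δ ] 𝟙 (a Fin.≟ b)
      ≡⟨ sym (∑-distrib-+ (allFin δ) _ _) ⟩
    ∑[ a ∈ allFin δ ] (length (child a x) + 𝟙 (a Fin.≟ b))
      ≡⟨ ∑-cong (allFin δ) (λ a _ → one-each a) ⟩
    ∑[ _ ∈ allFin δ ] 1
      ≡⟨ trans (∑-const (allFin δ) 1) (trans (*-identityʳ _) (length-allFin δ)) ⟩
    δ ∎
    where
    open ≡-Reasoning
    x : Vertex
    x = b ∷ w , r
    one-each : ∀ a → length (child a x) + 𝟙 (a Fin.≟ b) ≡ 1
    one-each a with a Fin.≟ b
    ... | yes _ = refl
    ... | no _  = refl

  δ∸1≤length-children : ∀ x → δ ∸ 1 ≤ length (children x)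
  δ∸1≤length-children ([] , _)    = ≤-trans (m∸n≤m δ 1) (≤-reflexive (sym length-children-root))
  δ∸1≤length-children (b ∷ w , r) = ≤-reflexive (trans (cong (_∸ 1) (sym (length-children-∷ b w r))) (m+n∸n≡m _ 1))

  length-children≤δ∸1 : ∀ x → 0 < length (proj₁ x) → length (children x) ≤ δ ∸ 1
  length-children≤δ∸1 (b ∷ w , r) _ = ≤-reflexive (trans (sym (m+n∸n≡m _ 1)) (cong (_∸ 1) (length-children-∷ b w r)))

  length-descendants-≥ : ∀ m x → (δ ∸ 1) ^ m ≤ length (descendants m x)
  length-descendants-≥ zero    x = ≤-refl
  length-descendants-≥ (suc m) x = begin
    (δ ∸ 1) * (δ ∸ 1) ^ m                    ≤⟨ *-monoˡ-≤ _ (δ∸1≤length-children x) ⟩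
    length (children x) * (δ ∸ 1) ^ m        ≡⟨ sym (∑-const (children x) _) ⟩
    ∑[ _ ∈ children x ] ((δ ∸ 1) ^ m)      ≤⟨ ∑-mono (children x) (λ c _ → length-descendants-≥ m c) ⟩
    ∑[ c ∈ children x ] length (descendants m c) ≡⟨ sym (length-concatMap (children x) (descendants m)) ⟩
    length (descendants (suc m) x)           ∎
    where open ≤-Reasoning

  length-descendants-≤ : ∀ m x → 0 < length (proj₁ x) → length (descendants m x) ≤ (δ ∸ 1) ^ m
  length-descendants-≤ zero    x _   = ≤-refl
  length-descendants-≤ (suc m) x 0<∣x∣ = begin
    length (descendants (suc m) x)           ≡⟨ length-concatMap (children x) (descendants m) ⟩
    ∑[ c ∈ children x ] length (descendants m c) ≤⟨ ∑-≤-const (children x) (λ c c∈ → length-descendants-≤ m c (0<∣c∣ c∈)) ⟩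
    length (children x) * (δ ∸ 1) ^ m        ≤⟨ *-monoˡ-≤ _ (length-children≤δ∸1 x 0<∣x∣) ⟩
    (δ ∸ 1) * (δ ∸ 1) ^ m                    ∎
    where
    open ≤-Reasoning
    0<∣c∣ : ∀ {c} → c ∈ children x → 0 < length (proj₁ c)
    0<∣c∣ c∈ = ≤-trans (s≤s z≤n) (≤-reflexive (sym (cong length (proj₂ (∈-children⇒≡ x c∈)))))

  ∈-descendants⇒drop : ∀ m x {t} → t ∈ descendants m x → drop m (proj₁ t) ≡ proj₁ x
  ∈-descendants⇒drop m x t∈ with ∈-descendants⇒≡ m x t∈
  ... | p , t≡ , refl = trans (cong (drop (length p)) t≡) (drop-length-++ p (proj₁ x))

  ∑-child≤ : ∀ a x (g : Word → ℕ) → ∑[ c ∈ child a x ] g (proj₁ c) ≤ g (a ∷ proj₁ x)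
  ∑-child≤ a ([] , _)    g = ≤-reflexive (+-identityʳ _)
  ∑-child≤ a (b ∷ w , r) g with a Fin.≟ b
  ... | yes _ = z≤n
  ... | no _  = ≤-reflexive (+-identityʳ _)

  ∑-𝟙-∷≤1 : ∀ w v → ∑[ a ∈ allFin δ ] 𝟙 ((a ∷ w) ≟ᵂ v) ≤ 1
  ∑-𝟙-∷≤1 w []      = ≤-trans (≤-reflexive (trans (∑-const (allFin δ) 0) (*-zeroʳ (length (allFin δ))))) z≤n
  ∑-𝟙-∷≤1 w (b ∷ v) = begin
    ∑[ a ∈ allFin δ ] 𝟙 ((a ∷ w) ≟ᵂ (b ∷ v))
      ≤⟨ ∑-mono (allFin δ) (λ a _ → 𝟙-mono List.∷-injectiveˡ ((a ∷ w) ≟ᵂ (b ∷ v)) (a Fin.≟ b)) ⟩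
    ∑[ a ∈ allFin δ ] 𝟙 (a Fin.≟ b)
      ≡⟨ ∑-𝟙-allFin b ⟩
    1 ∎
    where open ≤-Reasoning

  multiplicity-children≤1 : ∀ x v → ∑[ c ∈ children x ] 𝟙 (proj₁ c ≟ᵂ v) ≤ 1
  multiplicity-children≤1 x v = begin
    ∑[ c ∈ children x ] 𝟙 (proj₁ c ≟ᵂ v)
      ≡⟨ ∑-concatMap (allFin δ) (λ a → child a x) (λ c → 𝟙 (proj₁ c ≟ᵂ v)) ⟩
    ∑[ a ∈ allFin δ ] ∑[ c ∈ child a x ] 𝟙 (proj₁ c ≟ᵂ v)
      ≤⟨ ∑-mono (allFin δ) (λ a _ → ∑-child≤ a x (λ w → 𝟙 (w ≟ᵂ v))) ⟩
    ∑[ a ∈ allFin δ ] 𝟙 ((a ∷ proj₁ x) ≟ᵂ v)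
      ≤⟨ ∑-𝟙-∷≤1 (proj₁ x) v ⟩
    1 ∎
    where open ≤-Reasoning

  multiplicity-descendants≤1 : ∀ m x u → ∑[ t ∈ descendants m x ] 𝟙 (proj₁ t ≟ᵂ u) ≤ 1
  multiplicity-descendants≤1 zero    x u = ≤-trans (≤-reflexive (+-identityʳ _)) (𝟙≤1 (proj₁ x ≟ᵂ u))
  multiplicity-descendants≤1 (suc m) x u = begin
    ∑[ t ∈ descendants (suc m) x ] 𝟙 (proj₁ t ≟ᵂ u)
      ≡⟨ ∑-concatMap (children x) (descendants m) (λ t → 𝟙 (proj₁ t ≟ᵂ u)) ⟩
    ∑[ c ∈ children x ] ∑[ t ∈ descendants m c ] 𝟙 (proj₁ t ≟ᵂ u)
      ≤⟨ ∑-mono (children x) (λ c _ → through c) ⟩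
    ∑[ c ∈ children x ] 𝟙 (proj₁ c ≟ᵂ drop m u)
      ≤⟨ multiplicity-children≤1 x (drop m u) ⟩
    1 ∎
    where
    open ≤-Reasoning
    through : ∀ c → ∑[ t ∈ descendants m c ] 𝟙 (proj₁ t ≟ᵂ u) ≤ 𝟙 (proj₁ c ≟ᵂ drop m u)
    through c with proj₁ c ≟ᵂ drop m u
    ... | yes _  = multiplicity-descendants≤1 m c u
    ... | no c≢ = ≤-trans (∑-≤-const (descendants m c) absent) (≤-reflexive (*-zeroʳ (length (descendants m c))))
      where
      absent : ∀ t → t ∈ descendants m c → 𝟙 (proj₁ t ≟ᵂ u) ≤ 0
      absent t t∈ = ≤-reflexive (𝟙-no (proj₁ t ≟ᵂ u)
        (λ t≡u → c≢ (trans (sym (∈-descendants⇒drop m c t∈)) (cong (drop m) t≡u))))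

  ancestor : ℕ → Word → Word
  ancestor k u = drop (length u ∸ k) u

  ancestor-self : ∀ u → ancestor (length u) u ≡ u
  ancestor-self u = cong (λ n → drop n u) (n∸n≡0 (length u))

  ancestor-∷-∷ : ∀ k a b u → k ≤ length u → ancestor k (a ∷ b ∷ u) ≡ ancestor k u
  ancestor-∷-∷ k a b u k≤∣u∣ = cong (λ n → drop n (a ∷ b ∷ u)) (+-∸-assoc 2 k≤∣u∣)

  ancestor-descendant : ∀ n x {t} → t ∈ descendants n x → ancestor (length (proj₁ x)) (proj₁ t) ≡ proj₁ x
  ancestor-descendant n x {t} t∈ = begin
    drop (length (proj₁ t) ∸ length (proj₁ x)) (proj₁ t)
      ≡⟨ cong (λ k → drop (k ∸ length (proj₁ x)) (proj₁ t)) (depth-descendants n x t∈) ⟩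
    drop (n + length (proj₁ x) ∸ length (proj₁ x)) (proj₁ t)
      ≡⟨ cong (λ k → drop k (proj₁ t)) (m+n∸n≡m n (length (proj₁ x))) ⟩
    drop n (proj₁ t)
      ≡⟨ ∈-descendants⇒drop n x t∈ ⟩
    proj₁ x ∎
    where open ≡-Reasoning

  depth-descendants-root : ∀ k {w} → w ∈ descendants k root → length (proj₁ w) ≡ k
  depth-descendants-root k w∈ = trans (depth-descendants k root w∈) (+-identityʳ k)

  -- k ≥ 1 is needed because the root has δ rather than δ - 1 children.
  multiplicity-ancestors : ∀ k n → 0 < k → ∀ u →
    ∑[ t ∈ descendants (k + n) root ] 𝟙 (ancestor k (proj₁ t) ≟ᵂ u) ≤ (δ ∸ 1) ^ n
  multiplicity-ancestors k n 0<k u = begin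
    ∑[ t ∈ descendants (k + n) root ] 𝟙 (ancestor k (proj₁ t) ≟ᵂ u)
      ≡⟨ ∑-descendants-+ k n root _ ⟩
    ∑[ w ∈ descendants k root ] ∑[ t ∈ descendants n w ] 𝟙 (ancestor k (proj₁ t) ≟ᵂ u)
      ≡⟨ ∑-cong (descendants k root) (λ w w∈ → trans (∑-cong (descendants n w) (λ t t∈ → cong (λ v → 𝟙 (v ≟ᵂ u)) (ancestor≡ w∈ t∈)))
                                                      (∑-const (descendants n w) _)) ⟩
    ∑[ w ∈ descendants k root ] (length (descendants n w) * 𝟙 (proj₁ w ≟ᵂ u))
      ≤⟨ ∑-mono (descendants k root) (λ w w∈ → *-monoˡ-≤ _ (length-descendants-≤ n w (0<depth w∈))) ⟩
    ∑[ w ∈ descendants k root ] ((δ ∸ 1) ^ n * 𝟙 (proj₁ w ≟ᵂ u))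
      ≡⟨ ∑-distribˡ-* (descendants k root) ((δ ∸ 1) ^ n) _ ⟩
    (δ ∸ 1) ^ n * ∑[ w ∈ descendants k root ] 𝟙 (proj₁ w ≟ᵂ u)
      ≤⟨ *-monoʳ-≤ ((δ ∸ 1) ^ n) (multiplicity-descendants≤1 k root u) ⟩
    (δ ∸ 1) ^ n * 1
      ≡⟨ *-identityʳ _ ⟩
    (δ ∸ 1) ^ n ∎
    where
    open ≤-Reasoning
    0<depth : ∀ {w} → w ∈ descendants k root → 0 < length (proj₁ w)
    0<depth w∈ = ≤-trans 0<k (≤-reflexive (sym (depth-descendants-root k w∈)))
    ancestor≡ : ∀ {w t} → w ∈ descendants k root → t ∈ descendants n w → ancestor k (proj₁ t) ≡ proj₁ w
    ancestor≡ {w} {t} w∈ t∈ =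
      trans (cong (λ j → ancestor j (proj₁ t)) (sym (depth-descendants-root k w∈))) (ancestor-descendant n w t∈)

  -- Over-approximates the closed neighbourhood of u: the words need not be reduced.
  neighbourhood : Word → List Word
  neighbourhood u = u ∷ drop 1 u ∷ map (_∷ u) (allFin δ)

  ball : ℕ → Word → List Word
  ball zero    u = u ∷ []
  ball (suc k) u = concatMap (ball k) (neighbourhood u)

  centre∈ball : ∀ k u → u ∈ ball k u
  centre∈ball zero    u = here refl
  centre∈ball (suc k) u = ∈-concatMap⁺ (ball k) {xs = neighbourhood u} (here (centre∈ball k u))

  adjacent∈neighbourhood : ∀ {x y} → E T x y → proj₁ y ∈ neighbourhood (proj₁ x)
  adjacent∈neighbourhood {x} (inj₁ (a , y≡)) =
    there (there (subst (_∈ map (_∷ proj₁ x) (allFin δ)) (sym y≡) (∈-map⁺ (_∷ proj₁ x) (∈-allFin a))))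
  adjacent∈neighbourhood (inj₂ (a , x≡)) = there (here (sym (cong (drop 1) x≡)))

  walk⇒∈ball : ∀ {k x y} → Walk T k x y → proj₁ y ∈ ball k (proj₁ x)
  walk⇒∈ball {k} {x} here = centre∈ball k (proj₁ x)
  walk⇒∈ball {suc k} {x} {y} (step {w = z} e w) =
    ∈-concatMap⁺ (ball k) {xs = neighbourhood (proj₁ x)}
      (lose {P = λ v → proj₁ y ∈ ball k v} (adjacent∈neighbourhood {x} {z} e) (walk⇒∈ball w))

  length-ball : ∀ k u → length (ball k u) ≤ (2 + δ) ^ k
  length-ball zero    u = ≤-refl
  length-ball (suc k) u = begin
    length (ball (suc k) u)                         ≡⟨ length-concatMap (neighbourhood u) (ball k) ⟩
    ∑[ v ∈ neighbourhood u ] length (ball k v)      ≤⟨ ∑-≤-const (neighbourhood u) (λ v _ → length-ball k v) ⟩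
    length (neighbourhood u) * (2 + δ) ^ k
      ≡⟨ cong (λ n → (2 + n) * (2 + δ) ^ k) (trans (length-map _ (allFin δ)) (length-allFin δ)) ⟩
    (2 + δ) ^ suc k                                 ∎
    where open ≤-Reasoning

  walk-depth : ∀ {k x y} → Walk T k x y → length (proj₁ y) ≤ k + length (proj₁ x)
  walk-depth {k} {x} here = m≤n+m _ k
  walk-depth {suc k} {x} (step (inj₁ (a , w≡)) w) =
    ≤-trans (walk-depth w) (≤-reflexive (trans (cong (k +_) (cong length w≡)) (+-suc k _)))
  walk-depth {suc k} {x} (step (inj₂ (a , x≡)) w) =
    ≤-trans (walk-depth w) (≤-trans (+-monoʳ-≤ k (≤-trans (n≤1+n _) (≤-reflexive (sym (cong length x≡))))) (n≤1+n _))

  Reduced-tail : ∀ {a : Fin δ} {w} → Reduced (a ∷ w) → Reduced w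
  Reduced-tail {w = []}    _       = tt
  Reduced-tail {w = _ ∷ _} (_ , r) = r

  walk-to-root : ∀ w (r : Reduced w) → Walk T (length w) (w , r) root
  walk-to-root []      _ = here
  walk-to-root (a ∷ w) r = step (inj₂ (a , refl)) (walk-to-root w (Reduced-tail r))

  walk-via-root : ∀ x y → Walk T (length (proj₁ x) + length (proj₁ y)) x y
  walk-via-root x y = walk-++ T (walk-to-root (proj₁ x) (proj₂ x)) (walk-reverse T (walk-to-root (proj₁ y) (proj₂ y)))

  vertex-at-depth : 2 ≤ δ → ∀ n → Σ[ t ∈ Vertex ] length (proj₁ t) ≡ n
  vertex-at-depth 2≤δ n = head (descendants n root) (depth-descendants-root n) (length-descendants-≥ n root)
    where
    1≤b^n : 1 ≤ (δ ∸ 1) ^ n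
    1≤b^n = ≤-trans (≤-reflexive (sym (^-zeroˡ n))) (^-monoˡ-≤ n (∸-monoˡ-≤ 1 2≤δ))
    head : (ts : List Vertex) → (∀ {t} → t ∈ ts → length (proj₁ t) ≡ n) → (δ ∸ 1) ^ n ≤ length ts →
           Σ[ t ∈ Vertex ] length (proj₁ t) ≡ n
    head []      _     b^n≤0 = ⊥-elim (<-irrefl refl (≤-trans 1≤b^n b^n≤0))
    head (t ∷ _) depth _     = t , depth (here refl)

¬¬-choice-≤ : (R : ℕ → B → Set) → (∀ n → ¬ ¬ Σ B (R n)) →
              ∀ T → ¬ ¬ (Σ[ g ∈ (ℕ → B) ] (∀ n → n ≤ T → R n (g n)))
¬¬-choice-≤ R choose zero = do
  (b , rb) ← choose 0
  pure ((λ _ → b) , λ { zero _ → rb })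
¬¬-choice-≤ {B = B} R choose (suc T) = do
  (g , rg) ← ¬¬-choice-≤ R choose T
  (b , rb) ← choose (suc T)
  pure (update g b , correct g rg b rb)
  where
  update : (ℕ → B) → B → ℕ → B
  update g b n with n ≟ suc T
  ... | yes _ = b
  ... | no _  = g n
  correct : ∀ g → (∀ n → n ≤ T → R n (g n)) → ∀ b → R (suc T) b → ∀ n → n ≤ suc T → R n (update g b n)
  correct g rg b rb n n≤ with n ≟ suc T
  ... | yes refl = rb
  ... | no n≢ with m≤n⇒m<n∨m≡n n≤
  ...   | inj₁ n< = rg n (≤-pred n<)
  ...   | inj₂ n≡ = ⊥-elim (n≢ n≡)

module _ {A B : Set} (π : B → A) where

  Represents : List A → List B → Set
  Represents as bs = length bs ≤ length as × (∀ z → π z ∈ as → Σ[ z′ ∈ B ] z′ ∈ bs × π z′ ≡ π z)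

  ¬¬-representatives : ∀ as → ¬ ¬ (Σ[ bs ∈ List B ] Represents as bs)
  ¬¬-representatives [] = pure ([] , z≤n , λ _ ())
  ¬¬-representatives (a ∷ as) = do
    (bs , ∣bs∣≤ , rep) ← ¬¬-representatives as
    yes (z₀ , πz₀≡a) ← ¬¬-excluded-middle {A = Σ[ z ∈ B ] π z ≡ a}
      where no ∄z → pure (bs , m≤n⇒m≤1+n ∣bs∣≤ , λ { z (here πz≡a) → ⊥-elim (∄z (z , πz≡a))
                                                    ; z (there z∈) → rep z z∈ })
    pure (z₀ ∷ bs , s≤s ∣bs∣≤ , λ { z (here πz≡a) → z₀ , here refl , trans πz₀≡a (sym πz≡a)
                                   ; z (there z∈) → let (z′ , z′∈ , πz′≡) = rep z z∈ in z′ , there z′∈ , πz′≡ })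

module _ (G : Graph) (lf : LocallyFinite G) where

  closedBall : List (V G) → ℕ → List (V G)
  closedBall X₀ zero    = X₀
  closedBall X₀ (suc n) = closedBall X₀ n ++ concatMap (λ v → proj₁ (lf v)) (closedBall X₀ n)

  Xs⊆closedBall : ∀ X₀ W n v → Xs G X₀ W n v → v ∈ closedBall X₀ n
  Xs⊆closedBall X₀ W zero    v v∈X₀                 = v∈X₀
  Xs⊆closedBall X₀ W (suc n) v (u , u∈X , inj₁ refl , _) = ∈-++⁺ˡ (Xs⊆closedBall X₀ W n u u∈X)
  Xs⊆closedBall X₀ W (suc n) v (u , u∈X , inj₂ e , _) =
    ∈-++⁺ʳ (closedBall X₀ n) (∈-concatMap⁺ (λ v → proj₁ (lf v)) {xs = closedBall X₀ n}
      (lose {P = λ u → v ∈ proj₁ (lf u)} (Xs⊆closedBall X₀ W n u u∈X) (proj₂ (lf u) v e)))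

module Burning (G : Graph) (X₀ : List (V G)) (W : ℕ → List (V G))
               (W-avoids-X : ∀ n v → Xs G X₀ W n v → ¬ v ∈ W (suc n)) where

  X : ℕ → V G → Set
  X = Xs G X₀ W

  Defended : ℕ → V G → Set
  Defended = InWs G W

  Defended-mono : ∀ {n m v} → n ≤ m → Defended n v → Defended m v
  Defended-mono n≤m (k , 1≤k , k≤n , v∈W) = k , 1≤k , ≤-trans k≤n n≤m , v∈W

  X⇒¬Defended : ∀ {n x} → X n x → ¬ Defended (suc n) x
  X⇒¬Defended {n} x∈X (k , 1≤k , k≤1+n , x∈W) with m≤n⇒m<n∨m≡n k≤1+n
  ... | inj₂ refl = W-avoids-X n _ x∈X x∈W
  X⇒¬Defended {zero}  x∈X (k , 1≤k , k≤1+n , x∈W) | inj₁ k<1 = <-irrefl refl (≤-trans (s≤s 1≤k) k<1)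
  X⇒¬Defended {suc n} (_ , _ , _ , _ , x∉Ws) (k , 1≤k , k≤1+n , x∈W) | inj₁ k<2+n =
    x∉Ws (k , 1≤k , ≤-pred k<2+n , x∈W)

  X-suc : ∀ {n x} → X n x → X (suc n) x
  X-suc x∈X = _ , x∈X , inj₁ refl , X⇒¬Defended x∈X , X⇒¬Defended x∈X

  X-mono : ∀ {n m x} → n ≤ m → X n x → X m x
  X-mono {n} {m} n≤m x∈X with m≤n⇒m<n∨m≡n n≤m
  ... | inj₂ refl = x∈X
  X-mono {n} {suc m} n≤m x∈X | inj₁ n<1+m = X-suc (X-mono (≤-pred n<1+m) x∈X)

  module _ (G′ : Graph) (π : V G′ → V G) (π-hom : ∀ {u v} → E G′ u v → E G (π u) (π v)) where

    spread : ∀ {n k x y} → X n (π x) → Walk G′ k x y →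
             ¬ ¬ (X (n + k) (π y) ⊎ Σ[ z ∈ V G′ ] Walk G′ k x z × Defended (n + k) (π z))
    spread {n} {k} x∈X here = pure (inj₁ (X-mono (m≤m+n n k) x∈X))
    spread {n} {suc k} {x} {y} x∈X (step {w = w} e walk) = do
      no w∉D ← ¬¬-excluded-middle {A = Defended (suc n) (π w)}
        where yes w∈D → pure (inj₂ (w , step e (walk-mono G′ z≤n here) , Defended-mono n+1≤n+k+1 w∈D))
      inj₁ y∈X ← spread (π x , x∈X , inj₂ (π-hom e) , X⇒¬Defended x∈X , w∉D) walk
        where inj₂ (z , w⇝z , z∈D) → pure (inj₂ (z , step e w⇝z , subst (λ j → Defended j (π z)) (sym (+-suc n k)) z∈D))
      pure (inj₁ (subst (λ j → X j (π y)) (sym (+-suc n k)) y∈X))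
      where
      n+1≤n+k+1 : suc n ≤ n + suc k
      n+1≤n+k+1 = ≤-trans (s≤s (m≤m+n n k)) (≤-reflexive (sym (+-suc n k)))

module TreeInSubgraph
  (H : Graph) (δ : ℕ) (3≤δ : 3 ≤ δ) (S : Subgraph H)
  (q : V (asGraph S) → V (RegularTree δ)) (lam ε c : ℕ)
  (q-lipschitz : ∀ x y k → Walk (asGraph S) k x y → Walk (RegularTree δ) (lam * k + ε) (q x) (q y))
  (q-expanding : ∀ x y k → Walk (RegularTree δ) k (q x) (q y) → Walk (asGraph S) (lam * k + lam * ε) x y)
  (q-dense : ∀ y → Σ[ x ∈ V (asGraph S) ] Walk (RegularTree δ) c (q x) y)
  where

  open RegularTreeCounting δ

  b : ℕ
  b = δ ∸ 1

  2≤b : 2 ≤ b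
  2≤b = ∸-monoˡ-≤ 1 3≤δ

  β : ℕ
  β = b * b

  4≤β : 4 ≤ β
  4≤β = *-mono-≤ 2≤b 2≤b

  2≤β : 2 ≤ β
  2≤β = ≤-trans (s≤s (s≤s z≤n)) 4≤β

  G₁ : Graph
  G₁ = asGraph S

  π : V G₁ → V H
  π = proj₁

  π-hom : ∀ {u v} → E G₁ u v → E H (π u) (π v)
  π-hom = Subgraph.F⊆E S

  s : Vertex → V G₁
  s t = proj₁ (q-dense t)

  s-close : ∀ t → Walk T c (q (s t)) t
  s-close t = proj₂ (q-dense t)

  s-walk : ∀ {k x y} → Walk T k x y → Walk G₁ (lam * (c + (k + c)) + lam * ε) (s x) (s y)
  s-walk {k} {x} {y} x⇝y = q-expanding (s x) (s y) _ (walk-++ T (s-close x) (walk-++ T x⇝y (walk-reverse T (s-close y))))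

  -- A vertex without neighbours would be at bounded distance from every tree vertex.
  has-neighbour : ∀ z → Σ[ u ∈ V G₁ ] E G₁ z u
  has-neighbour z with vertex-at-depth (≤-trans (n≤1+n 2) 3≤δ) (suc (c + length (proj₁ (q z))))
  ... | t , ∣t∣≡ with walk-trivial-or-neighbour G₁ (q-expanding z (s t) _ (walk-via-root (q z) (q (s t))))
  ...   | inj₂ neighbour = neighbour
  ...   | inj₁ z≡st = ⊥-elim (<-irrefl ∣t∣≡ (s≤s (walk-depth (subst (λ z → Walk T c (q z) t) (sym z≡st) (s-close t)))))

  -- The edges of asGraph S only depend on the underlying vertices of H.
  same-image⇒walk₂ : ∀ {z′ z} → π z′ ≡ π z → Walk G₁ 2 z′ z
  same-image⇒walk₂ {z′} {z} πz′≡πz with has-neighbour z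
  ... | u , e = step {w = u} (subst (λ v → Subgraph.F S v (proj₁ u)) (sym πz′≡πz) e)
                       (step {u = u} (E-sym G₁ {z} {u} e) (here {k = 0}))

  K : ℕ
  K = lam * (c + (2 + c)) + lam * ε

  R : ℕ
  R = lam * (2 + K) + ε + c

  near-image⇒∈ball : ∀ {z′ z x k} → π z′ ≡ π z → Walk G₁ k (s x) z → k ≤ K → proj₁ x ∈ ball R (proj₁ (q z′))
  near-image⇒∈ball {z′} {z} {x} {k} πz′≡πz sx⇝z k≤K = walk⇒∈ball (walk-mono T radius (walk-++ T z′⇝sx (s-close x)))
    where
    z′⇝sx : Walk T (lam * (2 + k) + ε) (q z′) (q (s x))
    z′⇝sx = q-lipschitz z′ (s x) (2 + k) (walk-++ G₁ (same-image⇒walk₂ πz′≡πz) (walk-reverse G₁ sx⇝z))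
    radius : lam * (2 + k) + ε + c ≤ R
    radius = +-monoˡ-≤ c (+-monoˡ-≤ ε (*-monoʳ-≤ lam (+-monoʳ-≤ 2 k≤K)))

  Vol : ℕ
  Vol = (2 + δ) ^ R

  threats : List (V G₁) → Word → ℕ
  threats Z w = ∑[ z ∈ Z ] multiplicity (ball R (proj₁ (q z))) w

  ∈ball⇒threat : ∀ {Z z w} → z ∈ Z → w ∈ ball R (proj₁ (q z)) → 1 ≤ threats Z w
  ∈ball⇒threat {Z} {z} {w} z∈Z w∈ball =
    ≤-trans (∈⇒multiplicity w∈ball) (∑-∈ (λ z → multiplicity (ball R (proj₁ (q z))) w) z∈Z)

  ∑-threats : ∀ Z (ts : List Vertex) (g : Vertex → Word) B → (∀ u → ∑[ t ∈ ts ] 𝟙 (g t ≟ᵂ u) ≤ B) →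
              ∑[ t ∈ ts ] threats Z (g t) ≤ length Z * (Vol * B)
  ∑-threats Z ts g B mult≤B = begin
    ∑[ t ∈ ts ] ∑[ z ∈ Z ] ∑[ u ∈ ball R (proj₁ (q z)) ] 𝟙 (g t ≟ᵂ u)
      ≡⟨ ∑-comm ts Z _ ⟩
    ∑[ z ∈ Z ] ∑[ t ∈ ts ] ∑[ u ∈ ball R (proj₁ (q z)) ] 𝟙 (g t ≟ᵂ u)
      ≡⟨ ∑-cong Z (λ z _ → ∑-comm ts (ball R (proj₁ (q z))) _) ⟩
    ∑[ z ∈ Z ] ∑[ u ∈ ball R (proj₁ (q z)) ] ∑[ t ∈ ts ] 𝟙 (g t ≟ᵂ u)
      ≤⟨ ∑-≤-const Z (λ z _ → ≤-trans (∑-≤-const (ball R (proj₁ (q z))) (λ u _ → mult≤B u))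
                                       (*-monoˡ-≤ B (length-ball R (proj₁ (q z))))) ⟩
    length Z * (Vol * B) ∎
    where open ≤-Reasoning

  module Containment (lf : LocallyFinite H) (f : ℕ → ℕ) (P : ℕ)
                     (budget : ∀ j → ∑[ i ∈ upTo (K * suc j) ] f (suc i) ≤ P * 2 ^ j) where

    -- r and M are large enough for the leaves at depth r + 2 M to outnumber all threats.
    r : ℕ
    r = suc (2 * (P * Vol))

    X₀ : List (V H)
    X₀ = map (π ∘ s) (descendants r root)

    module _ (W : ℕ → List (V H)) (W≤f : ∀ n → 1 ≤ n → length (W n) ≤ f n)
             (W-avoids-X : ∀ n v → Xs H X₀ W n v → ¬ v ∈ W (suc n))
             (N : ℕ) (X-stable : ∀ n → N ≤ n → ∀ v → Xs H X₀ W n v → Xs H X₀ W N v) where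

      open Burning H X₀ W W-avoids-X

      burnt⇒∈closedBall : ∀ {n v} → X n v → v ∈ closedBall H lf X₀ N
      burnt⇒∈closedBall {n} {v} v∈X with n ≤? N
      ... | yes n≤N = Xs⊆closedBall H lf X₀ W N v (X-mono n≤N v∈X)
      ... | no n≰N  = Xs⊆closedBall H lf X₀ W N v (X-stable n (<⇒≤ (≰⇒> n≰N)) v v∈X)

      module _ (RB : List (V G₁)) where

        M : ℕ
        M = suc (length RB * Vol)

        module _ (RB-covers : ∀ z → π z ∈ closedBall H lf X₀ N → Σ[ z′ ∈ V G₁ ] z′ ∈ RB × π z′ ≡ π z)
                 (WS : ℕ → List (V G₁)) (WS-represents : ∀ τ → τ ≤ K * M → Represents π (W τ) (WS τ)) where

          -- Defenders placed by time K (j + 1) near the ancestor of t at depth r + 2 j.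
          levelThreat : ℕ → Word → ℕ
          levelThreat j t = ∑[ i ∈ upTo (K * suc j) ] threats (WS (suc i)) (ancestor (r + double j) t)

          rayThreat : ℕ → Word → ℕ
          rayThreat i t = ∑[ j ∈ upTo i ] levelThreat j t

          Φ : Word → ℕ
          Φ t = threats RB t + rayThreat M t

          -- Along a ray of grandchildren, the fire keeps pace (x burns by time K i) unless
          -- a defender placed in time was near one of the ancestors, which rayThreat records.
          Ray : ℕ → Vertex → Set
          Ray i x = length (proj₁ x) ≡ r + double i × ¬ ¬ (X (K * i) (π (s x)) ⊎ 1 ≤ rayThreat i (proj₁ x))

          K*i+K≡ : ∀ i → K * i + K ≡ K * suc i
          K*i+K≡ i = trans (+-comm (K * i) K) (sym (*-suc K i))

          step-Ray : ∀ {i x y} → suc i ≤ M → Ray i x → y ∈ descendants 2 x → Ray (suc i) y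
          step-Ray {i} {x} {y} 1+i≤M (∣x∣≡ , x-burnt-or-threatened) y∈ with ∈-descendants⇒≡ 2 x y∈
          ... | a′ ∷ a ∷ [] , y≡ , _ = ∣y∣≡ , y-burnt-or-threatened
            where
            ∣y∣≡ : length (proj₁ y) ≡ r + double (suc i)
            ∣y∣≡ = trans (cong length y≡) (trans (cong (2 +_) ∣x∣≡) (sym (trans (+-suc r _) (cong suc (+-suc r _)))))

            same-ancestor : ∀ j → j ≤ i → ancestor (r + double j) (proj₁ y) ≡ ancestor (r + double j) (proj₁ x)
            same-ancestor j j≤i = trans (cong (ancestor (r + double j)) y≡)
              (ancestor-∷-∷ (r + double j) a′ a (proj₁ x) (≤-trans (+-monoʳ-≤ r (double-mono j≤i)) (≤-reflexive (sym ∣x∣≡))))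

            parent : ancestor (r + double i) (proj₁ y) ≡ proj₁ x
            parent = trans (same-ancestor i ≤-refl) (trans (cong (λ k → ancestor k (proj₁ x)) (sym ∣x∣≡)) (ancestor-self (proj₁ x)))

            rayThreat-inherited : rayThreat i (proj₁ y) ≡ rayThreat i (proj₁ x)
            rayThreat-inherited = ∑-cong (upTo i) (λ j j∈ → ∑-cong (upTo (K * suc j))
              (λ i′ _ → cong (threats (WS (suc i′))) (same-ancestor j (<⇒≤ (∈-upTo⁻ j∈)))))

            rayThreat-suc : rayThreat (suc i) (proj₁ y) ≡ rayThreat i (proj₁ y) + levelThreat i (proj₁ y)
            rayThreat-suc = ∑-upTo-∷ʳ i (λ j → levelThreat j (proj₁ y))

            in-window : ∀ {τ} → τ ≤ K * i + K → τ ≤ K * suc i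
            in-window τ≤ = ≤-trans τ≤ (≤-reflexive (K*i+K≡ i))

            blocked⇒threat : ∀ {z} → Walk G₁ K (s x) z → Defended (K * i + K) (π z) → 1 ≤ levelThreat i (proj₁ y)
            blocked⇒threat {z} sx⇝z (suc τ , _ , 1+τ≤ , πz∈W)
              with proj₂ (WS-represents (suc τ) (≤-trans (in-window 1+τ≤) (*-monoʳ-≤ K 1+i≤M))) z πz∈W
            ... | z′ , z′∈WS , πz′≡πz = ≤-trans (∈ball⇒threat z′∈WS x∈ball)
                                                (∑-∈ (λ i′ → threats (WS (suc i′)) (ancestor (r + double i) (proj₁ y)))
                                                     (∈-upTo⁺ (in-window 1+τ≤)))
              where
              x∈ball : ancestor (r + double i) (proj₁ y) ∈ ball R (proj₁ (q z′))
              x∈ball = subst (_∈ ball R (proj₁ (q z′))) (sym parent) (near-image⇒∈ball πz′≡πz sx⇝z ≤-refl)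

            y-burnt-or-threatened : ¬ ¬ (X (K * suc i) (π (s y)) ⊎ 1 ≤ rayThreat (suc i) (proj₁ y))
            y-burnt-or-threatened = do
              inj₁ x-burnt ← x-burnt-or-threatened
                where inj₂ x-threatened → pure (inj₂ (begin
                        1                                           ≤⟨ x-threatened ⟩
                        rayThreat i (proj₁ x)                       ≡⟨ sym rayThreat-inherited ⟩
                        rayThreat i (proj₁ y)                       ≤⟨ m≤m+n _ _ ⟩
                        rayThreat i (proj₁ y) + levelThreat i (proj₁ y) ≡⟨ sym rayThreat-suc ⟩
                        rayThreat (suc i) (proj₁ y)                 ∎))
              inj₁ y-burnt ← spread G₁ π (λ {u} {v} → π-hom {u} {v}) x-burnt (s-walk (descendant-walk 2 x y∈))
                where inj₂ (z , sx⇝z , z-defended) → pure (inj₂ (begin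
                        1                                           ≤⟨ blocked⇒threat sx⇝z z-defended ⟩
                        levelThreat i (proj₁ y)                     ≤⟨ m≤n+m _ _ ⟩
                        rayThreat i (proj₁ y) + levelThreat i (proj₁ y) ≡⟨ sym rayThreat-suc ⟩
                        rayThreat (suc i) (proj₁ y)                 ∎))
              pure (inj₁ (subst (λ n → X n (π (s y))) (K*i+K≡ i) y-burnt))
              where open ≤-Reasoning

          ray : ∀ m {i x t} → i + m ≤ M → Ray i x → t ∈ descendants (double m) x → Ray (i + m) t
          ray zero    {i} {x} _ ray-x (here refl) = subst (λ j → Ray j x) (sym (+-identityʳ i)) ray-x
          ray (suc m) {i} {x} {t} i+1+m≤M ray-x t∈ with ∈-descendants-+⁻ 2 (double m) x t∈
          ... | y , y∈ , t∈′ = subst (λ j → Ray j t) (sym (+-suc i m)) (ray m i+1+m≤M′ (step-Ray 1+i≤M ray-x y∈) t∈′)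
            where
            i+1+m≤M′ : suc i + m ≤ M
            i+1+m≤M′ = ≤-trans (≤-reflexive (sym (+-suc i m))) i+1+m≤M
            1+i≤M : suc i ≤ M
            1+i≤M = ≤-trans (s≤s (m≤m+n i m)) i+1+m≤M′

          ray-start : ∀ {a} → a ∈ descendants r root → Ray 0 a
          ray-start {a} a∈ = trans (depth-descendants-root r a∈) (sym (+-identityʳ r)) ,
                             pure (inj₁ (subst (λ n → X n (π (s a))) (sym (*-zeroʳ K)) (∈-map⁺ (π ∘ s) a∈)))

          burnt⇒threat : ∀ {n t} → X n (π (s t)) → 1 ≤ threats RB (proj₁ t)
          burnt⇒threat {t = t} t-burnt with RB-covers (s t) (burnt⇒∈closedBall t-burnt)
          ... | z′ , z′∈RB , πz′≡ = ∈ball⇒threat z′∈RB (near-image⇒∈ball πz′≡ here z≤n)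

          L : ℕ
          L = r + double M

          leaves : List Vertex
          leaves = descendants L root

          leaf-threatened : ∀ t → t ∈ leaves → 1 ≤ Φ (proj₁ t)
          leaf-threatened t t∈ with ∈-descendants-+⁻ r (double M) root t∈
          ... | a , a∈ , t∈′ = decidable-stable (1 ≤? Φ (proj₁ t)) (do
                inj₁ t-burnt ← proj₂ (ray M {0} ≤-refl (ray-start a∈) t∈′)
                  where inj₂ t-threatened → pure (≤-trans t-threatened (m≤n+m (rayThreat M (proj₁ t)) (threats RB (proj₁ t))))
                pure (≤-trans (burnt⇒threat t-burnt) (m≤m+n _ _)))

          ∑-threats-RB : ∑[ t ∈ leaves ] threats RB (proj₁ t) ≤ length RB * Vol
          ∑-threats-RB = ≤-trans (∑-threats RB leaves proj₁ 1 (multiplicity-descendants≤1 L root))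
                                 (≤-reflexive (cong (length RB *_) (*-identityʳ Vol)))

          ∑-levelThreat : ∀ j → j < M → ∑[ t ∈ leaves ] levelThreat j (proj₁ t) ≤ P * Vol * (2 ^ j * β ^ (M ∸ j))
          ∑-levelThreat j j<M = begin
            ∑[ t ∈ leaves ] levelThreat j (proj₁ t)
              ≡⟨ ∑-comm leaves (upTo (K * suc j)) _ ⟩
            ∑[ i ∈ upTo (K * suc j) ] ∑[ t ∈ leaves ] threats (WS (suc i)) (ancestor k (proj₁ t))
              ≤⟨ ∑-mono (upTo (K * suc j)) per-time ⟩
            ∑[ i ∈ upTo (K * suc j) ] (Vol * below * f (suc i))
              ≡⟨ ∑-distribˡ-* (upTo (K * suc j)) (Vol * below) (f ∘ suc) ⟩
            Vol * below * ∑[ i ∈ upTo (K * suc j) ] f (suc i)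
              ≤⟨ *-monoʳ-≤ (Vol * below) (budget j) ⟩
            Vol * below * (P * 2 ^ j)
              ≡⟨ rearrange Vol below P (2 ^ j) ⟩
            P * Vol * (2 ^ j * below)
              ≡⟨ cong (λ n → P * Vol * (2 ^ j * n)) (^-double b (M ∸ j)) ⟩
            P * Vol * (2 ^ j * β ^ (M ∸ j)) ∎
            where
            open ≤-Reasoning
            k = r + double j
            below = b ^ double (M ∸ j)
            L≡ : L ≡ k + double (M ∸ j)
            L≡ = trans (cong (r +_) (sym (double-+-∸ (<⇒≤ j<M)))) (sym (+-assoc r (double j) _))
            ancestors≤below : ∀ u → ∑[ t ∈ leaves ] 𝟙 (ancestor k (proj₁ t) ≟ᵂ u) ≤ below
            ancestors≤below u = subst (λ n → ∑[ t ∈ descendants n root ] 𝟙 (ancestor k (proj₁ t) ≟ᵂ u) ≤ below) (sym L≡)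
                                  (multiplicity-ancestors k (double (M ∸ j)) (s≤s z≤n) u)
            WS≤f : ∀ i → i ∈ upTo (K * suc j) → length (WS (suc i)) ≤ f (suc i)
            WS≤f i i∈ = ≤-trans (proj₁ (WS-represents (suc i) (≤-trans (∈-upTo⁻ i∈) (*-monoʳ-≤ K j<M))))
                                (W≤f (suc i) (s≤s z≤n))
            per-time : ∀ i → i ∈ upTo (K * suc j) →
                       ∑[ t ∈ leaves ] threats (WS (suc i)) (ancestor k (proj₁ t)) ≤ Vol * below * f (suc i)
            per-time i i∈ = ≤-trans (∑-threats (WS (suc i)) leaves (ancestor k ∘ proj₁) below ancestors≤below)
                                    (≤-trans (*-monoˡ-≤ (Vol * below) (WS≤f i i∈)) (≤-reflexive (*-comm _ (Vol * below))))
            rearrange : ∀ v b p x → v * b * (p * x) ≡ p * v * (x * b)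
            rearrange = solve-∀

          ∑-rayThreat : ∑[ t ∈ leaves ] rayThreat M (proj₁ t) ≤ P * Vol * (2 * β ^ M)
          ∑-rayThreat = begin
            ∑[ t ∈ leaves ] rayThreat M (proj₁ t)
              ≡⟨ ∑-comm leaves (upTo M) _ ⟩
            ∑[ j ∈ upTo M ] ∑[ t ∈ leaves ] levelThreat j (proj₁ t)
              ≤⟨ ∑-mono (upTo M) (λ j j∈ → ∑-levelThreat j (∈-upTo⁻ j∈)) ⟩
            ∑[ j ∈ upTo M ] (P * Vol * (2 ^ j * β ^ (M ∸ j)))
              ≡⟨ ∑-distribˡ-* (upTo M) (P * Vol) _ ⟩
            P * Vol * ∑[ j ∈ upTo M ] (2 ^ j * β ^ (M ∸ j))
              ≤⟨ *-monoʳ-≤ (P * Vol) (geometric-bound β 4≤β M) ⟩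
            P * Vol * (2 * β ^ M) ∎
            where open ≤-Reasoning

          threat-count-contradiction : ⊥
          threat-count-contradiction = <-irrefl refl (begin-strict
            b ^ L                                         ≤⟨ length-descendants-≥ L root ⟩
            length leaves                                 ≤⟨ length≤∑ leaves (λ t t∈ → leaf-threatened t t∈) ⟩
            ∑[ t ∈ leaves ] Φ (proj₁ t)                   ≡⟨ ∑-distrib-+ leaves _ _ ⟩
            ∑[ t ∈ leaves ] threats RB (proj₁ t) + ∑[ t ∈ leaves ] rayThreat M (proj₁ t)
                                                          ≤⟨ +-mono-≤ ∑-threats-RB ∑-rayThreat ⟩
            length RB * Vol + P * Vol * (2 * β ^ M)       <⟨ +-monoˡ-< (P * Vol * (2 * β ^ M)) (<⇒≤ (n<b^n β 2≤β M)) ⟩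
            β ^ M + P * Vol * (2 * β ^ M)                 ≡⟨ rearrange (β ^ M) (P * Vol) ⟩
            r * β ^ M                                     ≤⟨ *-monoˡ-≤ (β ^ M) (<⇒≤ (n<b^n b 2≤b r)) ⟩
            b ^ r * β ^ M                                 ≡⟨ cong (b ^ r *_) (sym (^-double b M)) ⟩
            b ^ r * b ^ double M                          ≡⟨ sym (^-distribˡ-+-* b r (double M)) ⟩
            b ^ L                                         ∎)
            where
            open ≤-Reasoning
            rearrange : ∀ y q → y + q * (2 * y) ≡ suc (2 * q) * y
            rearrange = solve-∀

      no-strategy : ⊥
      no-strategy =
        ¬¬-representatives π (closedBall H lf X₀ N) λ (RB , _ , RB-covers) →
        ¬¬-choice-≤ (λ τ → Represents π (W τ)) (λ τ → ¬¬-representatives π (W τ)) (K * M RB) λ (WS , WS-represents) →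
        threat-count-contradiction RB RB-covers WS WS-represents

    no-containment-strategy : ∀ W → ¬ ContainmentStrategy H f X₀ W
    no-containment-strategy W (W≤f , W-avoids-X , N , _ , stable) =
      no-strategy W W≤f W-avoids-X N (λ n N≤n v → proj₁ (stable n N≤n v))

corollary4p7 : (H : Graph) → LocallyFinite H →
    (δ : ℕ) → 3 ≤ δ →
    Σ[ S ∈ Subgraph H ] QuasiIsometric (asGraph S) (RegularTree δ) →
    (d : ℕ) → ¬ PolyContainment H d
corollary4p7 H lf δ 3≤δ (S , q , lam , ε , c , _ , q-lipschitz , q-expanding , q-dense) d (f , (C , n₀ , f≤Cn^d) , contain) =
  no-containment-strategy (proj₁ (contain X₀)) (proj₂ (contain X₀))
  where
  open TreeInSubgraph H δ 3≤δ S q lam ε c q-lipschitz q-expanding q-dense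
  open Σ (polynomial-budget f d C n₀ f≤Cn^d K) renaming (proj₁ to P; proj₂ to budget)
  open Containment lf f P budget
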